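{- Let $r,n\ge1$, let $\lambda$ be an $r$-row generalized partition, let $(c_1,\ldots,c_n)\in\{0,\pm1,\ldots,\pm r\}^n$, and let $\sigma\in\mathfrak S_n$. Then the number of $r$-row non-skew fluctuating tableaux of length $n$, shape $\lambda$ and type $(c_1,\ldots,c_n)$ equals the number of $r$-row non-skew fluctuating tableaux of length $n$, shape $\lambda$ and type $(c_{\sigma(1)},\ldots,c_{\sigma(n)})$.
   Context: An $r$-row generalized partition is $\lambda\in\mathbb Z^r$ with $\lambda_1\ge\cdots\ge\lambda_r$. $\mathcal A_r$ is the set of subsets $S\subseteq\{\pm1,\ldots,\pm r\}$ all of whose elements have the same sign (including $\emptyset$); $\mathbf e_S=\sum_{s\in S}\mathbf e_s$ if $S$ is positive and $\mathbf e_S=-\sum_{s\in S}\mathbf e_{ -s}$ if negative. An $r$-row non-skew fluctuating tableau of length $n$ is a sequence $0=\lambda^0,\lambda^1,\ldots,\lambda^n$ of $r$-row generalized partitions with $\lambda^k=\lambda^{k-1}+\mathbf e_{S_k}$, $S_k\in\mathcal A_r$; its shape is $\lambda^n$ and its type is $(c_1,\ldots,c_n)$ with $c_k=|S_k|$ if $S_k$ is positive and $c_k=-|S_k|$ if $S_k$ is negative ($c_k=0$ if $S_k=\emptyset$). -}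

module Defs where

open import Data.Nat using (ℕ; zero; suc)
open import Data.Integer as ℤ using (ℤ; +_; -[1+_]; 0ℤ; 1ℤ; -1ℤ; _+_)
open import Data.Fin as Fin using (Fin)
open import Data.Fin.Subset using (Subset; ∣_∣)
open import Data.Bool using (if_then_else_)
open import Data.Vec using (Vec; []; _∷_; last; lookup)
open import Data.Vec.Relation.Unary.All using (All)
open import Relation.Binary.PropositionalEquality using (_≡_)

IsGenPartition : ∀ {r} → (Fin r → ℤ) → Set
IsGenPartition {r} μ = ∀ (i j : Fin r) → i Fin.≤ j → μ j ℤ.≤ μ i

sgn : ℤ → ℤ
sgn (+ zero)   = 0ℤ
sgn (+ suc _)  = 1ℤ
sgn -[1+ _ ]   = -1ℤ

-- A step S_k with |c_k| = |S|, sign given by c_k, is encoded by a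
-- subset S of Fin r (the absolute values of its elements); e_S is
-- then  sgn c_k * (indicator of S).
stepVec : ∀ {r} → ℤ → Subset r → Fin r → ℤ
stepVec c S i = if lookup S i then sgn c else 0ℤ

walk : ∀ {r n} → (Fin r → ℤ) → (Fin n → ℤ) → (Fin n → Subset r) → Vec (Fin r → ℤ) (suc n)
walk {n = zero}  μ c S = μ ∷ []
walk {n = suc n} μ c S =
  μ ∷ walk (λ i → μ i + stepVec (c Fin.zero) (S Fin.zero) i) (λ k → c (Fin.suc k)) (λ k → S (Fin.suc k))

-- A tableau is determined by its sequence of steps S_1..S_n; the type
-- condition says S_k has |c_k| elements and the sign of c_k
-- (c_k = 0 forces S_k = ∅).
record FluctuatingTableau (r n : ℕ) (c : Fin n → ℤ) (λ' : Fin r → ℤ) : Set where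
  field
    steps      : Fin n → Subset r
    stepSizes  : ∀ k → ∣ steps k ∣ ≡ ℤ.∣ c k ∣
    partitions : All IsGenPartition (walk (λ _ → 0ℤ) c steps)
    shape      : ∀ i → last (walk (λ _ → 0ℤ) c steps) i ≡ λ' i

-- Two tableaux are the same tableau iff they have the same steps
-- (the remaining fields are proofs of propositions).
SameTableau : ∀ {r n c λ'} → FluctuatingTableau r n c λ' → FluctuatingTableau r n c λ' → Set
SameTableau t u = ∀ k → FluctuatingTableau.steps t k ≡ FluctuatingTableau.steps u k

-- A bijection between the sets of tableaux (up to SameTableau); for these
-- finite sets this is "the numbers are equal".
record TableauBijection {r n} (c d : Fin n → ℤ) (λ' : Fin r → ℤ) : Set where
  field
    to       : FluctuatingTableau r n c λ' → FluctuatingTableau r n d λ'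
    from     : FluctuatingTableau r n d λ' → FluctuatingTableau r n c λ'
    from-to  : ∀ t → SameTableau (from (to t)) t
    to-from  : ∀ u → SameTableau (to (from u)) u

-- Writing the permutation as a product of adjacent transpositions, it suffices
-- to exchange the types a, b of two consecutive steps S₁, S₂ bijectively while
-- keeping the partition reached after both steps.  A negative step S adds a box
-- to every row outside S and then removes one box from every row; such uniform
-- shifts do not affect being a partition, so it suffices to treat two positive
-- steps, i.e. adding a vertical strip X and then a vertical strip Y to μ.
-- Inside each maximal run of equal rows of μ, the rows receiving two boxes come
-- first, then the rows receiving one box, the X-boxes among the latter on top.
-- Handing out instead as many X-boxes to these one-box rows as the run had
-- Y-boxes, again on top, preserves the number of boxes added to every row and
-- all the partition conditions, exchanges |X| and |Y|, and is an involution.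

module Submission where

open import Defs
open import Data.Nat using (ℕ; _≤_)
open import Data.Integer as ℤ using (ℤ)
open import Data.Fin using (Fin)
open import Data.Fin.Permutation using (Permutation′; _⟨$⟩ʳ_)

open import Data.Bool using (Bool; true; false; _∧_; _∨_; if_then_else_; not)
open import Data.Bool.Properties using (not-involutive)
open import Data.Empty using (⊥-elim)
import Data.Fin as Fin
import Data.Fin.Permutation as Perm
import Data.Fin.Properties as Fin
open import Data.Fin.Subset using (Subset; ∣_∣; ∁)
open import Data.Fin.Subset.Properties using (∣∁p∣≡n∸∣p∣)
open import Data.Integer using (+_; -[1+_]; +[1+_]; 0ℤ; -1ℤ)
import Data.Integer.Properties as ℤ
import Data.Integer.Tactic.RingSolver as ℤSolver
open import Data.List using (List; []; _∷_)
import Data.List as List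
import Data.List.Properties as ListP
open import Data.List.Relation.Binary.Permutation.Propositional as ↭ using (_↭_)
open import Data.Maybe using (Maybe; just; nothing)
open import Data.Nat using (zero; suc; _+_; _∸_; z≤n; s≤s; pred)
import Data.Nat.Properties as ℕ
open import Data.Nat.Tactic.RingSolver using (solve-∀)
open import Data.Product using (Σ; _×_; _,_; proj₁; proj₂)
open import Data.Vec using (Vec; []; _∷_; map; sum; lookup; tabulate; last)
import Data.Vec.Properties as VecP
open import Data.Vec.Relation.Unary.All using (All; []; _∷_)
open import Data.Vec.Relation.Unary.Linked as Linked using (Linked; []; [-]; _∷_)
import Data.Vec.Relation.Unary.Linked.Properties as Linked
open import Function using (_on_; _∘_)
open import Relation.Binary.PropositionalEquality
open import Relation.Nullary using (yes; no; does; Dec)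
open import Algebra.Properties.CommutativeSemigroup ℕ.+-commutativeSemigroup using (interchange)
open import Algebra.Properties.AbelianGroup ℤ.+-0-abelianGroup using (\\-leftDividesʳ; //-rightDividesʳ)

𝟙 : Bool → ℕ
𝟙 true  = 1
𝟙 false = 0

𝟙≤1 : ∀ b → 𝟙 b ≤ 1
𝟙≤1 true  = s≤s z≤n
𝟙≤1 false = z≤n

positive : ℕ → Bool
positive zero    = false
positive (suc _) = true

𝟙-positive+pred : ∀ k → 𝟙 (positive k) + pred k ≡ k
𝟙-positive+pred zero    = refl
𝟙-positive+pred (suc k) = refl

-- A row of the diagram of μ: its length, whether the first of two
-- consecutive steps adds a box to it, and whether the second one does.
Row : Set
Row = ℤ × Bool × Bool

value : Row → ℤ
value (v , _ , _) = v

hasX hasY : Row → Bool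
hasX (_ , x , _) = x
hasY (_ , _ , y) = y

𝟙x 𝟙y 𝟙x∧y 𝟙x∨y added : Row → ℕ
𝟙x ρ = 𝟙 (hasX ρ)
𝟙y ρ = 𝟙 (hasY ρ)
𝟙x∧y ρ = 𝟙 (hasX ρ ∧ hasY ρ)
𝟙x∨y ρ = 𝟙 (hasX ρ ∨ hasY ρ)
added ρ = 𝟙x ρ + 𝟙y ρ

afterX afterXY : Row → ℤ
afterX ρ = value ρ ℤ.+ + 𝟙x ρ
afterXY ρ = value ρ ℤ.+ + added ρ

Descending : ∀ {n} → (Row → ℤ) → Vec Row n → Set
Descending g = Linked (ℤ._≥_ on g)

total : ∀ {n} → (Row → ℕ) → Vec Row n → ℕ
total f rs = sum (map f rs)

-- Runs of equal rows

runSum : ∀ {n} → ℤ → (Row → ℕ) → Vec Row n → ℕ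
runSum v f []       = 0
runSum v f (ρ ∷ ρs) = if does (v ℤ.≟ value ρ) then f ρ + runSum v f ρs else 0

runSum-here : ∀ {n v} f ρ (ρs : Vec Row n) → v ≡ value ρ → runSum v f (ρ ∷ ρs) ≡ f ρ + runSum v f ρs
runSum-here {v = v} f ρ ρs v≡ with v ℤ.≟ value ρ
... | yes _ = refl
... | no v≢ = ⊥-elim (v≢ v≡)

runSum-elsewhere : ∀ {n v} f ρ (ρs : Vec Row n) → v ≢ value ρ → runSum v f (ρ ∷ ρs) ≡ 0
runSum-elsewhere {v = v} f ρ ρs v≢ with v ℤ.≟ value ρ
... | yes v≡ = ⊥-elim (v≢ v≡)
... | no _ = refl

runSum-mono : ∀ {n} v {f g : Row → ℕ} → (∀ σ → f σ ≤ g σ) → (rs : Vec Row n) → runSum v f rs ≤ runSum v g rs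
runSum-mono v f≤g [] = z≤n
runSum-mono v f≤g (ρ ∷ ρs) with v ℤ.≟ value ρ
... | yes _ = ℕ.+-mono-≤ (f≤g ρ) (runSum-mono v f≤g ρs)
... | no _  = z≤n

runSum-+ : ∀ {n} v (f g : Row → ℕ) (rs : Vec Row n) → runSum v (λ σ → f σ + g σ) rs ≡ runSum v f rs + runSum v g rs
runSum-+ v f g [] = refl
runSum-+ v f g (ρ ∷ ρs) with v ℤ.≟ value ρ
... | yes _ = trans (cong (λ z → f ρ + g ρ + z) (runSum-+ v f g ρs)) (interchange (f ρ) (g ρ) _ _)
... | no _  = refl

runSum-cong : ∀ {n} v {f g : Row → ℕ} {rs ss : Vec Row n} →
              map value rs ≡ map value ss → map f rs ≡ map g ss → runSum v f rs ≡ runSum v g ss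
runSum-cong v {rs = []} {[]} _ _ = refl
runSum-cong v {rs = ρ ∷ ρs} {σ ∷ σs} values fs
  with value≡ , values′ ← VecP.∷-injective values | f≡ , fs′ ← VecP.∷-injective fs
  rewrite value≡ = cong (λ z → if does (v ℤ.≟ value σ) then z else 0) (cong₂ _+_ f≡ (runSum-cong v values′ fs′))

+-cancelˡ-≤ : ∀ a {m n} → a ℤ.+ + m ℤ.≤ a ℤ.+ + n → m ≤ n
+-cancelˡ-≤ a le = ℤ.drop‿+≤+ (subst₂ ℤ._≤_ (\\-leftDividesʳ a _) (\\-leftDividesʳ a _) (ℤ.+-monoʳ-≤ (ℤ.- a) le))

+-≤-across : ∀ {a b} → b ℤ.≤ a → b ≢ a → ∀ {m} n → m ≤ 1 → b ℤ.+ + m ℤ.≤ a ℤ.+ + n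
+-≤-across {a} {b} b≤a b≢a {m} n m≤1 = begin
  b ℤ.+ + m   ≤⟨ ℤ.+-monoʳ-≤ b (ℤ.+≤+ m≤1) ⟩
  b ℤ.+ + 1   ≡⟨ ℤ.+-comm b (+ 1) ⟩
  ℤ.suc b     ≤⟨ ℤ.i<j⇒suc[i]≤j (ℤ.≤∧≢⇒< b≤a b≢a) ⟩
  a           ≡⟨ ℤ.+-identityʳ a ⟨
  a ℤ.+ + 0   ≤⟨ ℤ.+-monoʳ-≤ a (ℤ.+≤+ z≤n) ⟩
  a ℤ.+ + n   ∎
  where open ℤ.≤-Reasoning

-- Below a row ρ in its run, value + h descending forces h σ ≤ h ρ.
runSum-≡0 : ∀ {n} (h f : Row → ℕ) t → (∀ σ → h σ ≤ t → f σ ≡ 0) →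
            ∀ ρ (ρs : Vec Row n) → h ρ ≤ t → Descending (λ σ → value σ ℤ.+ + h σ) (ρ ∷ ρs) →
            runSum (value ρ) f ρs ≡ 0
runSum-≡0 h f t f≡0 ρ [] _ _ = refl
runSum-≡0 h f t f≡0 ρ (σ ∷ σs) hρ≤t (σ≤ρ ∷ desc) with value ρ ℤ.≟ value σ
... | no _ = refl
... | yes ρ≡σ =
  cong₂ _+_ (f≡0 σ hσ≤t) (trans (cong (λ v → runSum v f σs) ρ≡σ) (runSum-≡0 h f t f≡0 σ σs hσ≤t desc))
  where
  hσ≤t : h σ ≤ t
  hσ≤t = ℕ.≤-trans (+-cancelˡ-≤ (value σ) (subst (λ v → value σ ℤ.+ + h σ ℤ.≤ v ℤ.+ + h ρ) ρ≡σ σ≤ρ)) hρ≤t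

𝟙x∧y≤𝟙y : ∀ ρ → 𝟙x∧y ρ ≤ 𝟙y ρ
𝟙x∧y≤𝟙y (_ , true  , _) = ℕ.≤-refl
𝟙x∧y≤𝟙y (_ , false , _) = z≤n

𝟙y≤𝟙x∨y : ∀ ρ → 𝟙y ρ ≤ 𝟙x∨y ρ
𝟙y≤𝟙x∨y (_ , true  , true ) = ℕ.≤-refl
𝟙y≤𝟙x∨y (_ , true  , false) = z≤n
𝟙y≤𝟙x∨y (_ , false , _    ) = ℕ.≤-refl

𝟙x∧y≤𝟙x∨y : ∀ ρ → 𝟙x∧y ρ ≤ 𝟙x∨y ρ
𝟙x∧y≤𝟙x∨y ρ = ℕ.≤-trans (𝟙x∧y≤𝟙y ρ) (𝟙y≤𝟙x∨y ρ)

added≤1⇒𝟙x∧y≡0 : ∀ ρ → added ρ ≤ 1 → 𝟙x∧y ρ ≡ 0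
added≤1⇒𝟙x∧y≡0 (_ , true  , true ) (s≤s ())
added≤1⇒𝟙x∧y≡0 (_ , true  , false) _ = refl
added≤1⇒𝟙x∧y≡0 (_ , false , _    ) _ = refl

added≤0⇒𝟙x∨y≡0 : ∀ ρ → added ρ ≤ 0 → 𝟙x∨y ρ ≡ 0
added≤0⇒𝟙x∨y≡0 (_ , false , false) _ = refl

-- Exchanging X-boxes and Y-boxes run by run

-- The row gets an X-box iff b; its remaining boxes are Y-boxes.
relabel : Bool → Row → Row
relabel b (v , x , y) = v , b , (if b then x ∧ y else x ∨ y)

quota : ∀ {n} → Maybe ℤ → ℕ → Row → Vec Row n → ℕ
quota (just v) k ρ ρs = if does (v ℤ.≟ value ρ) then k else runSum (value ρ) 𝟙y (ρ ∷ ρs)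
quota nothing  k ρ ρs = runSum (value ρ) 𝟙y (ρ ∷ ρs)

-- Scanning the rows top-down, the state is the length of the current run
-- (if any) and the number k of X-boxes it still has to receive.  A new run
-- of length w receives as many X-boxes as it had Y-boxes; they are handed
-- out, one per row, to the topmost rows that received a box at all.
reassign : ∀ {n} → Maybe ℤ → ℕ → Vec Row n → Vec Row n
reassign m k []       = []
reassign m k (ρ ∷ ρs) = relabel (positive K) ρ ∷ reassign (just (value ρ)) (pred K) ρs
  where K = quota m k ρ ρs

swapRows : ∀ {n} → Vec Row n → Vec Row n
swapRows = reassign nothing 0

pending : ∀ {n} → Maybe ℤ → (Row → ℕ) → Vec Row n → ℕ
pending nothing  f rs = 0
pending (just v) f rs = runSum v f rs

-- Rows that received two boxes keep an X-box and rows that received none get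
-- none, so the quota must lie between these two counts over the rest of the run.
QuotaFits : ∀ {n} → Maybe ℤ → ℕ → Vec Row n → Set
QuotaFits m k rs = pending m 𝟙x∧y rs ≤ k × k ≤ pending m 𝟙x∨y rs

runSum-𝟙y-fits : ∀ {n} ρ (ρs : Vec Row n) → QuotaFits (just (value ρ)) (runSum (value ρ) 𝟙y (ρ ∷ ρs)) (ρ ∷ ρs)
runSum-𝟙y-fits ρ ρs = runSum-mono (value ρ) 𝟙x∧y≤𝟙y (ρ ∷ ρs) , runSum-mono (value ρ) 𝟙y≤𝟙x∨y (ρ ∷ ρs)

quota-continue : ∀ {n v} k ρ (ρs : Vec Row n) → v ≡ value ρ → quota (just v) k ρ ρs ≡ k
quota-continue {v = v} k ρ ρs v≡ with v ℤ.≟ value ρ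
... | yes _ = refl
... | no v≢ = ⊥-elim (v≢ v≡)

quota-fresh : ∀ {n v} k ρ (ρs : Vec Row n) → v ≢ value ρ → quota (just v) k ρ ρs ≡ runSum (value ρ) 𝟙y (ρ ∷ ρs)
quota-fresh {v = v} k ρ ρs v≢ with v ℤ.≟ value ρ
... | yes v≡ = ⊥-elim (v≢ v≡)
... | no _ = refl

quota-fits : ∀ {n} m k ρ (ρs : Vec Row n) → QuotaFits m k (ρ ∷ ρs) → QuotaFits (just (value ρ)) (quota m k ρ ρs) (ρ ∷ ρs)
quota-fits nothing  k ρ ρs _ = runSum-𝟙y-fits ρ ρs
quota-fits (just v) k ρ ρs fits = byCase (v ℤ.≟ value ρ)
  where
  byCase : Dec (v ≡ value ρ) → QuotaFits (just (value ρ)) (quota (just v) k ρ ρs) (ρ ∷ ρs)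
  byCase (yes v≡) = subst₂ (λ u K → QuotaFits (just u) K (ρ ∷ ρs)) v≡ (sym (quota-continue k ρ ρs v≡)) fits
  byCase (no v≢)  = subst (λ K → QuotaFits (just (value ρ)) K (ρ ∷ ρs)) (sym (quota-fresh k ρ ρs v≢)) (runSum-𝟙y-fits ρ ρs)

added-relabel : ∀ b ρ → (b ≡ true → hasX ρ ∨ hasY ρ ≡ true) → (hasX ρ ∧ hasY ρ ≡ true → b ≡ true) →
                added (relabel b ρ) ≡ added ρ
added-relabel true  (_ , true  , y    ) _ _ = refl
added-relabel true  (_ , false , true ) _ _ = refl
added-relabel true  (_ , false , false) b⇒ _ with () ← b⇒ refl
added-relabel false (_ , true  , true ) _ ⇒b with () ← ⇒b refl
added-relabel false (_ , true  , false) _ _ = refl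
added-relabel false (_ , false , y    ) _ _ = refl

relabel-fits : ∀ {n} ρ (ρs : Vec Row n) K → QuotaFits (just (value ρ)) K (ρ ∷ ρs) → Descending afterXY (ρ ∷ ρs) →
               QuotaFits (just (value ρ)) (pred K) ρs × added (relabel (positive K) ρ) ≡ added ρ
relabel-fits (w , x , y) ρs K (lo , hi) desc
  rewrite runSum-here 𝟙x∧y (w , x , y) ρs refl | runSum-here 𝟙x∨y (w , x , y) ρs refl = cases x y K desc lo hi
  where
  no-x∧y : ∀ x y → added (w , x , y) ≤ 1 → Descending afterXY ((w , x , y) ∷ ρs) → runSum w 𝟙x∧y ρs ≡ 0
  no-x∧y x y added≤1 = runSum-≡0 added 𝟙x∧y 1 added≤1⇒𝟙x∧y≡0 (w , x , y) ρs added≤1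

  one-box : ∀ x y K → added (w , x , y) ≡ 1 → Descending afterXY ((w , x , y) ∷ ρs) →
            K ≤ 1 + runSum w 𝟙x∨y ρs → QuotaFits (just w) (pred K) ρs
  one-box x y K one desc hi =
    subst (_≤ pred K) (sym (no-x∧y x y (ℕ.≤-reflexive one) desc)) z≤n , ℕ.pred-mono-≤ hi

  cases : ∀ x y K → Descending afterXY ((w , x , y) ∷ ρs) →
          𝟙 (x ∧ y) + runSum w 𝟙x∧y ρs ≤ K → K ≤ 𝟙 (x ∨ y) + runSum w 𝟙x∨y ρs →
          QuotaFits (just w) (pred K) ρs × added (relabel (positive K) (w , x , y)) ≡ added (w , x , y)
  cases true  true  (suc K) _ (s≤s lo) (s≤s hi) = (lo , hi) , refl
  cases true  false K desc _ hi = one-box true false K refl desc hi , added-relabel (positive K) (w , true , false) (λ _ → refl) (λ ())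
  cases false true  K desc _ hi = one-box false true K refl desc hi , added-relabel (positive K) (w , false , true) (λ _ → refl) (λ ())
  cases false false K desc _ hi = (ℕ.≤-trans (runSum-mono w 𝟙x∧y≤𝟙x∨y ρs) (subst (_≤ pred K) (sym no-x∨y) z≤n) ,
                                   ℕ.≤-trans ℕ.pred[n]≤n hi) ,
                                  subst (λ K → added (relabel (positive K) (w , false , false)) ≡ 0) (sym K≡0) refl
    where
    no-x∨y : runSum w 𝟙x∨y ρs ≡ 0
    no-x∨y = runSum-≡0 added 𝟙x∨y 0 added≤0⇒𝟙x∨y≡0 (w , false , false) ρs z≤n desc
    K≡0 : K ≡ 0
    K≡0 = ℕ.n≤0⇒n≡0 (subst (K ≤_) no-x∨y hi)

reassign-step : ∀ {n} m k ρ (ρs : Vec Row n) → QuotaFits m k (ρ ∷ ρs) → Descending afterXY (ρ ∷ ρs) →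
                QuotaFits (just (value ρ)) (pred (quota m k ρ ρs)) ρs ×
                added (relabel (positive (quota m k ρ ρs)) ρ) ≡ added ρ
reassign-step m k ρ ρs fits = relabel-fits ρ ρs (quota m k ρ ρs) (quota-fits m k ρ ρs fits)

reassign-values : ∀ {n} m k (rs : Vec Row n) → map value (reassign m k rs) ≡ map value rs
reassign-values m k []                = refl
reassign-values m k ((w , x , y) ∷ ρs) = cong (w ∷_) (reassign-values _ _ ρs)

reassign-added : ∀ {n} m k (rs : Vec Row n) → QuotaFits m k rs → Descending afterXY rs →
                 map added (reassign m k rs) ≡ map added rs
reassign-added m k []       _    _    = refl
reassign-added m k (ρ ∷ ρs) fits desc =
  let fits′ , kept = reassign-step m k ρ ρs fits desc
  in cong₂ _∷_ kept (reassign-added _ _ ρs fits′ (Linked.tail desc))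

𝟙-positive-pred≤ : ∀ k → 𝟙 (positive (pred k)) ≤ 𝟙 (positive k)
𝟙-positive-pred≤ zero          = z≤n
𝟙-positive-pred≤ (suc zero)    = z≤n
𝟙-positive-pred≤ (suc (suc k)) = ℕ.≤-refl

reassign-afterX : ∀ {n} m k (rs : Vec Row n) → Descending value rs → Descending afterX (reassign m k rs)
reassign-afterX m k []                                   _ = []
reassign-afterX m k (ρ ∷ [])                             _ = [-]
reassign-afterX m k ((w , x , y) ∷ (w′ , x′ , y′) ∷ σs) (w′≤w ∷ desc) =
  head-step ∷ reassign-afterX (just w) (pred K) ((w′ , x′ , y′) ∷ σs) desc
  where
  K = quota m k (w , x , y) ((w′ , x′ , y′) ∷ σs)
  head-step : w′ ℤ.+ + 𝟙 (positive (quota (just w) (pred K) (w′ , x′ , y′) σs)) ℤ.≤ w ℤ.+ + 𝟙 (positive K)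
  head-step with w ℤ.≟ w′
  ... | yes refl = ℤ.+-monoʳ-≤ w (ℤ.+≤+ (𝟙-positive-pred≤ K))
  ... | no w≢w′  = +-≤-across w′≤w (λ w′≡w → w≢w′ (sym w′≡w)) _ (𝟙≤1 _)

reassign-runSum-x : ∀ {n} v k (rs : Vec Row n) → QuotaFits (just v) k rs → Descending afterXY rs →
                    runSum v 𝟙x (reassign (just v) k rs) ≡ k
reassign-runSum-x v k [] (_ , k≤0) _ = sym (ℕ.n≤0⇒n≡0 k≤0)
reassign-runSum-x v k ((w , x , y) ∷ ρs) fits desc with v ℤ.≟ w | reassign-step (just v) k (w , x , y) ρs fits desc
... | yes refl | fits′ , _ =
  trans (cong (λ z → 𝟙 (positive k) + z) (reassign-runSum-x v (pred k) ρs fits′ (Linked.tail desc))) (𝟙-positive+pred k)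
... | no v≢w   | _ = sym (ℕ.n≤0⇒n≡0 (subst (k ≤_) (runSum-elsewhere 𝟙x∨y (w , x , y) ρs v≢w) (proj₂ fits)))

total-+ : ∀ {n} (f g : Row → ℕ) (rs : Vec Row n) → total (λ σ → f σ + g σ) rs ≡ total f rs + total g rs
total-+ f g []       = refl
total-+ f g (ρ ∷ ρs) = trans (cong (λ z → f ρ + g ρ + z) (total-+ f g ρs)) (interchange (f ρ) (g ρ) _ _)

quota-balance : ∀ {n} m k ρ (ρs : Vec Row n) → QuotaFits m k (ρ ∷ ρs) →
                quota m k ρ ρs + pending m 𝟙y (ρ ∷ ρs) ≡ k + runSum (value ρ) 𝟙y (ρ ∷ ρs)
quota-balance nothing  k ρ ρs (_ , k≤0) rewrite ℕ.n≤0⇒n≡0 k≤0 = ℕ.+-identityʳ _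
quota-balance (just v) k ρ ρs (_ , k≤) = byCase (v ℤ.≟ value ρ)
  where
  open ≡-Reasoning
  byCase : Dec (v ≡ value ρ) → quota (just v) k ρ ρs + runSum v 𝟙y (ρ ∷ ρs) ≡ k + runSum (value ρ) 𝟙y (ρ ∷ ρs)
  byCase (yes v≡) = cong₂ _+_ (quota-continue k ρ ρs v≡) (cong (λ u → runSum u 𝟙y (ρ ∷ ρs)) v≡)
  byCase (no v≢) = begin
    quota (just v) k ρ ρs + runSum v 𝟙y (ρ ∷ ρs)
      ≡⟨ cong₂ _+_ (quota-fresh k ρ ρs v≢) (runSum-elsewhere 𝟙y ρ ρs v≢) ⟩
    runSum (value ρ) 𝟙y (ρ ∷ ρs) + 0             ≡⟨ ℕ.+-identityʳ _ ⟩
    runSum (value ρ) 𝟙y (ρ ∷ ρs)                 ≡⟨ cong (λ z → z + runSum (value ρ) 𝟙y (ρ ∷ ρs)) k≡0 ⟨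
    k + runSum (value ρ) 𝟙y (ρ ∷ ρs)             ∎
    where
    k≡0 : k ≡ 0
    k≡0 = ℕ.n≤0⇒n≡0 (subst (k ≤_) (runSum-elsewhere 𝟙x∨y ρ ρs v≢) k≤)

-- Every run receives as many X-boxes as it had Y-boxes.
reassign-total-x : ∀ {n} m k (rs : Vec Row n) → QuotaFits m k rs → Descending afterXY rs →
                   total 𝟙x (reassign m k rs) + pending m 𝟙y rs ≡ k + total 𝟙y rs
reassign-total-x nothing  k [] (_ , k≤0) _ = sym (trans (ℕ.+-identityʳ k) (ℕ.n≤0⇒n≡0 k≤0))
reassign-total-x (just v) k [] (_ , k≤0) _ = sym (trans (ℕ.+-identityʳ k) (ℕ.n≤0⇒n≡0 k≤0))
reassign-total-x m k ((w , x , y) ∷ ρs) fits desc = ℕ.+-cancelʳ-≡ R _ _ (begin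
  𝟙 b + tx + P + R         ≡⟨ shuffle₁ (𝟙 b) tx P R ⟩
  𝟙 b + (tx + R) + P       ≡⟨ cong (λ z → 𝟙 b + z + P) ih ⟩
  𝟙 b + (pred K + ty) + P  ≡⟨ shuffle₂ (𝟙 b) (pred K) ty P ⟩
  (𝟙 b + pred K) + P + ty  ≡⟨ cong (λ z → z + P + ty) (𝟙-positive+pred K) ⟩
  K + P + ty               ≡⟨ cong (λ z → z + ty) (quota-balance m k (w , x , y) ρs fits) ⟩
  k + runSum w 𝟙y ((w , x , y) ∷ ρs) + ty ≡⟨ cong (λ z → k + z + ty) (runSum-here 𝟙y (w , x , y) ρs refl) ⟩
  k + (𝟙 y + R) + ty       ≡⟨ shuffle₃ k (𝟙 y) R ty ⟩
  k + (𝟙 y + ty) + R       ∎)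
  where
  open ≡-Reasoning
  K = quota m k (w , x , y) ρs
  b = positive K
  P = pending m 𝟙y ((w , x , y) ∷ ρs)
  R = runSum w 𝟙y ρs
  tx = total 𝟙x (reassign (just w) (pred K) ρs)
  ty = total 𝟙y ρs
  ih : tx + R ≡ pred K + ty
  ih = reassign-total-x (just w) (pred K) ρs (proj₁ (reassign-step m k (w , x , y) ρs fits desc)) (Linked.tail desc)
  shuffle₁ : ∀ a b c d → a + b + c + d ≡ a + (b + d) + c
  shuffle₁ = solve-∀
  shuffle₂ : ∀ a b c d → a + (b + c) + d ≡ a + b + d + c
  shuffle₂ = solve-∀
  shuffle₃ : ∀ a b c d → a + (b + c) + d ≡ a + (b + d) + c
  shuffle₃ = solve-∀

positive-𝟙+ : ∀ x r → (x ≡ false → r ≡ 0) → positive (𝟙 x + r) ≡ x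
positive-𝟙+ true  r _    = refl
positive-𝟙+ false r r≡0 = cong positive (r≡0 refl)

pred-𝟙+ : ∀ x r → (x ≡ false → r ≡ 0) → pred (𝟙 x + r) ≡ r
pred-𝟙+ true  r _    = refl
pred-𝟙+ false r r≡0 = trans (cong pred (r≡0 refl)) (sym (r≡0 refl))

relabel-relabel : ∀ b ρ → added (relabel b ρ) ≡ added ρ → relabel (hasX ρ) (relabel b ρ) ≡ ρ
relabel-relabel true  (w , true  , y    ) _ = refl
relabel-relabel false (w , true  , true ) ()
relabel-relabel false (w , true  , false) _ = refl
relabel-relabel true  (w , false , true ) _ = refl
relabel-relabel true  (w , false , false) ()
relabel-relabel false (w , false , y    ) _ = refl

reassign-runSum-added : ∀ {n} v m k (rs : Vec Row n) → QuotaFits m k rs → Descending afterXY rs →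
                        runSum v added (reassign m k rs) ≡ runSum v added rs
reassign-runSum-added v m k rs fits desc = runSum-cong v (reassign-values m k rs) (reassign-added m k rs fits desc)

fresh-run-swapped : ∀ {n} m k ρ (ρs : Vec Row n) → QuotaFits m k (ρ ∷ ρs) → Descending afterXY (ρ ∷ ρs) →
                    quota m k ρ ρs ≡ runSum (value ρ) 𝟙y (ρ ∷ ρs) →
                    runSum (value ρ) 𝟙y (reassign m k (ρ ∷ ρs)) ≡ runSum (value ρ) 𝟙x (ρ ∷ ρs)
fresh-run-swapped m k ρ@(w , x , y) ρs fits desc K≡Y = ℕ.+-cancelˡ-≡ Y _ _ (begin
  Y + Y′        ≡⟨ cong (_+ Y′) (trans (sym K≡Y) (sym X′≡K)) ⟩
  X′ + Y′       ≡⟨ runSum-+ w 𝟙x 𝟙y new ⟨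
  runSum w added new ≡⟨ reassign-runSum-added w m k (ρ ∷ ρs) fits desc ⟩
  runSum w added (ρ ∷ ρs) ≡⟨ runSum-+ w 𝟙x 𝟙y (ρ ∷ ρs) ⟩
  X + Y         ≡⟨ ℕ.+-comm X Y ⟩
  Y + X         ∎)
  where
  open ≡-Reasoning
  K = quota m k ρ ρs
  new = reassign m k (ρ ∷ ρs)
  X = runSum w 𝟙x (ρ ∷ ρs)
  Y = runSum w 𝟙y (ρ ∷ ρs)
  X′ = runSum w 𝟙x new
  Y′ = runSum w 𝟙y new
  X′≡K : X′ ≡ K
  X′≡K = begin
    X′ ≡⟨ runSum-here 𝟙x (relabel (positive K) ρ) (reassign (just w) (pred K) ρs) refl ⟩
    𝟙 (positive K) + runSum w 𝟙x (reassign (just w) (pred K) ρs)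
      ≡⟨ cong (λ z → 𝟙 (positive K) + z)
              (reassign-runSum-x w (pred K) ρs (proj₁ (reassign-step m k ρ ρs fits desc)) (Linked.tail desc)) ⟩
    𝟙 (positive K) + pred K ≡⟨ 𝟙-positive+pred K ⟩
    K ∎

second-quota : ∀ {n} m k k₂ ρ (ρs : Vec Row n) → QuotaFits m k (ρ ∷ ρs) → Descending afterXY (ρ ∷ ρs) →
               k₂ ≡ pending m 𝟙x (ρ ∷ ρs) →
               let K = quota m k ρ ρs in
               quota m k₂ (relabel (positive K) ρ) (reassign (just (value ρ)) (pred K) ρs) ≡ runSum (value ρ) 𝟙x (ρ ∷ ρs)
second-quota nothing  k k₂ ρ@(w , x , y) ρs fits desc _ = fresh-run-swapped nothing k ρ ρs fits desc refl
second-quota (just v) k k₂ ρ@(w , x , y) ρs fits desc k₂≡ = byCase (v ℤ.≟ w)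
  where
  K = quota (just v) k ρ ρs
  o = relabel (positive K) ρ
  T = reassign (just w) (pred K) ρs
  byCase : Dec (v ≡ w) → quota (just v) k₂ o T ≡ runSum w 𝟙x (ρ ∷ ρs)
  byCase (yes v≡w) = trans (quota-continue k₂ o T v≡w) (trans k₂≡ (cong (λ u → runSum u 𝟙x (ρ ∷ ρs)) v≡w))
  byCase (no v≢w)  = trans (quota-fresh k₂ o T v≢w) (fresh-run-swapped (just v) k ρ ρs fits desc (quota-fresh k ρ ρs v≢w))

reassign-involutive : ∀ {n} m k k₂ (rs : Vec Row n) → QuotaFits m k rs → k₂ ≡ pending m 𝟙x rs →
                      Descending afterX rs → Descending afterXY rs → reassign m k₂ (reassign m k rs) ≡ rs
reassign-involutive m k k₂ []       _    _   _     _      = refl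
reassign-involutive m k k₂ (ρ@(w , x , y) ∷ ρs) fits k₂≡ descX descXY =
  cong₂ _∷_ head-restored (reassign-involutive (just w) (pred K) (pred K₂) ρs fits′ pred-K₂ (Linked.tail descX) (Linked.tail descXY))
  where
  K = quota m k ρ ρs
  K₂ = quota m k₂ (relabel (positive K) ρ) (reassign (just w) (pred K) ρs)
  head-facts = reassign-step m k ρ ρs fits descXY
  fits′ = proj₁ head-facts

  no-x-below : x ≡ false → runSum w 𝟙x ρs ≡ 0
  no-x-below refl = runSum-≡0 𝟙x 𝟙x 0 (λ σ → ℕ.n≤0⇒n≡0) ρ ρs z≤n descX

  K₂≡ : K₂ ≡ 𝟙 x + runSum w 𝟙x ρs
  K₂≡ = trans (second-quota m k k₂ ρ ρs fits descXY k₂≡) (runSum-here 𝟙x ρ ρs refl)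

  pred-K₂ : pred K₂ ≡ runSum w 𝟙x ρs
  pred-K₂ = trans (cong pred K₂≡) (pred-𝟙+ x _ no-x-below)

  head-restored : relabel (positive K₂) (relabel (positive K) ρ) ≡ ρ
  head-restored = trans (cong (λ b → relabel b (relabel (positive K) ρ)) (trans (cong positive K₂≡) (positive-𝟙+ x _ no-x-below)))
                        (relabel-relabel (positive K) ρ (proj₂ head-facts))

module _ {n} {rs : Vec Row n} where

  swapRows-values : map value (swapRows rs) ≡ map value rs
  swapRows-values = reassign-values nothing 0 rs

  swapRows-added : Descending afterXY rs → map added (swapRows rs) ≡ map added rs
  swapRows-added = reassign-added nothing 0 rs (z≤n , z≤n)

  swapRows-afterX : Descending value rs → Descending afterX (swapRows rs)
  swapRows-afterX = reassign-afterX nothing 0 rs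

  swapRows-total-x : Descending afterXY rs → total 𝟙x (swapRows rs) ≡ total 𝟙y rs
  swapRows-total-x desc = trans (sym (ℕ.+-identityʳ _)) (reassign-total-x nothing 0 rs (z≤n , z≤n) desc)

  swapRows-total-y : Descending afterXY rs → total 𝟙y (swapRows rs) ≡ total 𝟙x rs
  swapRows-total-y desc = ℕ.+-cancelˡ-≡ (total 𝟙y rs) _ _ (begin
    total 𝟙y rs + total 𝟙y (swapRows rs)                 ≡⟨ cong (_+ total 𝟙y (swapRows rs)) (swapRows-total-x desc) ⟨
    total 𝟙x (swapRows rs) + total 𝟙y (swapRows rs)      ≡⟨ total-+ 𝟙x 𝟙y (swapRows rs) ⟨
    total added (swapRows rs)                           ≡⟨ cong sum (swapRows-added desc) ⟩
    total added rs                                      ≡⟨ total-+ 𝟙x 𝟙y rs ⟩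
    total 𝟙x rs + total 𝟙y rs                           ≡⟨ ℕ.+-comm (total 𝟙x rs) _ ⟩
    total 𝟙y rs + total 𝟙x rs                           ∎)
    where open ≡-Reasoning

  swapRows-involutive : Descending afterX rs → Descending afterXY rs → swapRows (swapRows rs) ≡ rs
  swapRows-involutive = reassign-involutive nothing 0 0 rs (z≤n , z≤n) refl

partition-cong : ∀ {r} {f g : Fin r → ℤ} → IsGenPartition f → (∀ i → g i ≡ f i) → IsGenPartition g
partition-cong f-part g≗f i j i≤j = subst₂ ℤ._≤_ (sym (g≗f j)) (sym (g≗f i)) (f-part i j i≤j)

partition-shift : ∀ {r} {f g : Fin r → ℤ} s → IsGenPartition f → (∀ i → g i ≡ f i ℤ.+ s) → IsGenPartition g
partition-shift s f-part g≡ i j i≤j = subst₂ ℤ._≤_ (sym (g≡ j)) (sym (g≡ i)) (ℤ.+-monoˡ-≤ s (f-part i j i≤j))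

partition-unshift : ∀ {r} {f g : Fin r → ℤ} s → IsGenPartition g → (∀ i → g i ≡ f i ℤ.+ s) → IsGenPartition f
partition-unshift {f = f} {g} s g-part g≡ = partition-shift (ℤ.- s) g-part λ i → sym (begin
  g i ℤ.+ ℤ.- s          ≡⟨ cong (ℤ._+ ℤ.- s) (g≡ i) ⟩
  f i ℤ.+ s ℤ.+ ℤ.- s    ≡⟨ //-rightDividesʳ s (f i) ⟩
  f i                    ∎)
  where open ≡-Reasoning

linked-tabulate : ∀ {r} (f : Fin r → ℤ) → IsGenPartition f → Linked ℤ._≥_ (tabulate f)
linked-tabulate {zero}        f _      = []
linked-tabulate {suc zero}    f _      = [-]
linked-tabulate {suc (suc r)} f f-part =
  f-part Fin.zero (Fin.suc Fin.zero) z≤n ∷ linked-tabulate (f ∘ Fin.suc) (λ i j i≤j → f-part (Fin.suc i) (Fin.suc j) (s≤s i≤j))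

partition-lookup : ∀ {r} {v : Vec ℤ r} → Linked ℤ._≥_ v → IsGenPartition (lookup v)
partition-lookup desc i j i≤j with i Fin.≟ j
... | yes refl = ℤ.≤-refl
... | no i≢j   = Linked.lookup⁺ (λ a≥b b≥c → ℤ.≤-trans b≥c a≥b) desc (Fin.≤∧≢⇒< i≤j i≢j)

descending-tabulate : ∀ {r} (g : Row → ℤ) (row : Fin r → Row) s {f : Fin r → ℤ} → IsGenPartition f →
                      (∀ i → f i ≡ g (row i) ℤ.+ s) → Descending g (tabulate row)
descending-tabulate g row s f-part f≡ =
  Linked.map⁻ (subst (Linked ℤ._≥_) (VecP.tabulate-∘ g row) (linked-tabulate (g ∘ row) (partition-unshift s f-part f≡)))

partition-descending : ∀ {r} (g : Row → ℤ) (rs : Vec Row r) s {f : Fin r → ℤ} → Descending g rs →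
                       (∀ i → f i ≡ g (lookup rs i) ℤ.+ s) → IsGenPartition f
partition-descending g rs s desc f≡ =
  partition-shift s (partition-lookup (Linked.map⁺ desc)) (λ i → trans (f≡ i) (cong (ℤ._+ s) (sym (VecP.lookup-map i g rs))))

-- Steps of either sign as shifted positive steps

raised : ∀ {r} → ℤ → Subset r → Subset r
raised (+ _)    S = S
raised -[1+ _ ] S = ∁ S

shift : ℤ → ℤ
shift (+ _)    = 0ℤ
shift -[1+ _ ] = -1ℤ

raised-involutive : ∀ {r} c (S : Subset r) → raised c (raised c S) ≡ S
raised-involutive (+ _)    S = refl
raised-involutive -[1+ _ ] S = trans (sym (VecP.map-∘ not not S)) (trans (VecP.map-cong not-involutive S) (VecP.map-id S))

∣raised∣ : ∀ {r} c {A B : Subset r} → ∣ A ∣ ≡ ∣ B ∣ → ∣ raised c A ∣ ≡ ∣ raised c B ∣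
∣raised∣ (+ _)    eq = eq
∣raised∣ {r} -[1+ _ ] {A} {B} eq = trans (∣∁p∣≡n∸∣p∣ A) (trans (cong (r ∸_) eq) (sym (∣∁p∣≡n∸∣p∣ B)))

lookup-empty : ∀ {r} (S : Subset r) → ∣ S ∣ ≡ 0 → ∀ i → lookup S i ≡ false
lookup-empty (false ∷ S) eq Fin.zero    = refl
lookup-empty (false ∷ S) eq (Fin.suc i) = lookup-empty S eq i

stepVec-raised : ∀ {r} c (S : Subset r) → ∣ S ∣ ≡ ℤ.∣ c ∣ →
                 ∀ i → stepVec c S i ≡ + 𝟙 (lookup (raised c S) i) ℤ.+ shift c
stepVec-raised (+ zero)  S eq i rewrite lookup-empty S eq i = refl
stepVec-raised +[1+ _ ]  S eq i with lookup S i
... | true  = refl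
... | false = refl
stepVec-raised -[1+ _ ] S eq i rewrite VecP.lookup-map i not S with lookup S i
... | true  = refl
... | false = refl

next : ∀ {r} → (Fin r → ℤ) → ℤ → Subset r → Fin r → ℤ
next μ c S i = μ i ℤ.+ stepVec c S i

record ValidPair {r} (μ : Fin r → ℤ) (a b : ℤ) (S₁ S₂ : Subset r) : Set where
  field
    start  : IsGenPartition μ
    size₁  : ∣ S₁ ∣ ≡ ℤ.∣ a ∣
    size₂  : ∣ S₂ ∣ ≡ ℤ.∣ b ∣
    middle : IsGenPartition (next μ a S₁)
    end    : IsGenPartition (next (next μ a S₁) b S₂)

rowsOf : ∀ {r} → (Fin r → ℤ) → Subset r → Subset r → Vec Row r
rowsOf μ A B = tabulate (λ i → μ i , lookup A i , lookup B i)

swapSteps : ∀ {r} → (Fin r → ℤ) → ℤ → ℤ → Subset r → Subset r → Subset r × Subset r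
swapSteps μ a b S₁ S₂ = raised b (map hasX R) , raised a (map hasY R)
  where R = swapRows (rowsOf μ (raised a S₁) (raised b S₂))

swapSteps-cong : ∀ {r} {μ μ′ : Fin r → ℤ} → (∀ i → μ i ≡ μ′ i) →
                 ∀ a b S₁ S₂ → swapSteps μ a b S₁ S₂ ≡ swapSteps μ′ a b S₁ S₂
swapSteps-cong μ≗μ′ a b S₁ S₂ =
  cong (λ rows → raised b (map hasX (swapRows rows)) , raised a (map hasY (swapRows rows)))
       (VecP.tabulate-cong (λ i → cong (_, _) (μ≗μ′ i)))

map-hasX-rowsOf : ∀ {r} (μ : Fin r → ℤ) A B → map hasX (rowsOf μ A B) ≡ A
map-hasX-rowsOf μ A B = trans (sym (VecP.tabulate-∘ hasX _)) (VecP.tabulate∘lookup A)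

map-hasY-rowsOf : ∀ {r} (μ : Fin r → ℤ) A B → map hasY (rowsOf μ A B) ≡ B
map-hasY-rowsOf μ A B = trans (sym (VecP.tabulate-∘ hasY _)) (VecP.tabulate∘lookup B)

∣map∣ : ∀ {n} (f : Row → Bool) (rs : Vec Row n) → ∣ map f rs ∣ ≡ total (𝟙 ∘ f) rs
∣map∣ f []       = refl
∣map∣ f (ρ ∷ ρs) with f ρ
... | true  = cong suc (∣map∣ f ρs)
... | false = ∣map∣ f ρs

two-steps : ∀ {r} (μ : Fin r → ℤ) c d (S S′ : Subset r) → ∣ S ∣ ≡ ℤ.∣ c ∣ → ∣ S′ ∣ ≡ ℤ.∣ d ∣ → ∀ i →
            next (next μ c S) d S′ i ≡
            μ i ℤ.+ + (𝟙 (lookup (raised c S) i) + 𝟙 (lookup (raised d S′) i)) ℤ.+ (shift c ℤ.+ shift d)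
two-steps μ c d S S′ S-size S′-size i = begin
  μ i ℤ.+ stepVec c S i ℤ.+ stepVec d S′ i
    ≡⟨ cong₂ (λ u v → μ i ℤ.+ u ℤ.+ v) (stepVec-raised c S S-size i) (stepVec-raised d S′ S′-size i) ⟩
  μ i ℤ.+ (+ p ℤ.+ shift c) ℤ.+ (+ q ℤ.+ shift d)  ≡⟨ regroup (μ i) (+ p) (+ q) (shift c) (shift d) ⟩
  μ i ℤ.+ (+ p ℤ.+ + q) ℤ.+ (shift c ℤ.+ shift d)  ≡⟨ cong (λ z → μ i ℤ.+ z ℤ.+ (shift c ℤ.+ shift d)) (ℤ.pos-+ p q) ⟨
  μ i ℤ.+ + (p + q) ℤ.+ (shift c ℤ.+ shift d)      ∎
  where
  open ≡-Reasoning
  p = 𝟙 (lookup (raised c S) i)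
  q = 𝟙 (lookup (raised d S′) i)
  regroup : ∀ m p q s t → m ℤ.+ (p ℤ.+ s) ℤ.+ (q ℤ.+ t) ≡ m ℤ.+ (p ℤ.+ q) ℤ.+ (s ℤ.+ t)
  regroup = ℤSolver.solve-∀

lookup-map-≡ : ∀ {A B : Set} {n} (f : A → B) {xs ys : Vec A n} → map f xs ≡ map f ys → ∀ i → f (lookup xs i) ≡ f (lookup ys i)
lookup-map-≡ f {xs} {ys} eq i = trans (sym (VecP.lookup-map i f xs)) (trans (cong (λ v → lookup v i) eq) (VecP.lookup-map i f ys))

module _ {r} {μ : Fin r → ℤ} {a b S₁ S₂} (valid : ValidPair μ a b S₁ S₂) where
  open ValidPair valid
  open ≡-Reasoning

  private
    P₁ = raised a S₁
    P₂ = raised b S₂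
    rows = rowsOf μ P₁ P₂
    R = swapRows rows
    Q₁ = map hasX R
    Q₂ = map hasY R
    T₁ = proj₁ (swapSteps μ a b S₁ S₂)
    T₂ = proj₂ (swapSteps μ a b S₁ S₂)

    rows-value : Descending value rows
    rows-value = descending-tabulate value _ 0ℤ start (λ i → sym (ℤ.+-identityʳ (μ i)))

    rows-afterX : Descending afterX rows
    rows-afterX = descending-tabulate afterX _ (shift a) middle
      (λ i → trans (cong (λ z → μ i ℤ.+ z) (stepVec-raised a S₁ size₁ i)) (sym (ℤ.+-assoc (μ i) _ (shift a))))

    rows-afterXY : Descending afterXY rows
    rows-afterXY = descending-tabulate afterXY _ (shift a ℤ.+ shift b) end (two-steps μ a b S₁ S₂ size₁ size₂)

    R-value : ∀ i → value (lookup R i) ≡ μ i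
    R-value i = trans (lookup-map-≡ value (swapRows-values {rs = rows}) i) (cong value (VecP.lookup∘tabulate _ i))

    R-added : ∀ i → 𝟙 (lookup Q₁ i) + 𝟙 (lookup Q₂ i) ≡ 𝟙 (lookup P₁ i) + 𝟙 (lookup P₂ i)
    R-added i = begin
      𝟙 (lookup Q₁ i) + 𝟙 (lookup Q₂ i)
        ≡⟨ cong₂ (λ x y → 𝟙 x + 𝟙 y) (VecP.lookup-map i hasX R) (VecP.lookup-map i hasY R) ⟩
      added (lookup R i)                 ≡⟨ lookup-map-≡ added (swapRows-added rows-afterXY) i ⟩
      added (lookup rows i)              ≡⟨ cong added (VecP.lookup∘tabulate _ i) ⟩
      𝟙 (lookup P₁ i) + 𝟙 (lookup P₂ i)  ∎

    raised-T₁ : raised b T₁ ≡ Q₁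
    raised-T₁ = raised-involutive b Q₁

    raised-T₂ : raised a T₂ ≡ Q₂
    raised-T₂ = raised-involutive a Q₂

    ∣Q₁∣ : ∣ Q₁ ∣ ≡ ∣ P₂ ∣
    ∣Q₁∣ = begin
      ∣ Q₁ ∣                  ≡⟨ ∣map∣ hasX R ⟩
      total 𝟙x R              ≡⟨ swapRows-total-x rows-afterXY ⟩
      total 𝟙y rows           ≡⟨ ∣map∣ hasY rows ⟨
      ∣ map hasY rows ∣       ≡⟨ cong ∣_∣ (map-hasY-rowsOf μ P₁ P₂) ⟩
      ∣ P₂ ∣                  ∎

    ∣Q₂∣ : ∣ Q₂ ∣ ≡ ∣ P₁ ∣
    ∣Q₂∣ = begin
      ∣ Q₂ ∣                  ≡⟨ ∣map∣ hasY R ⟩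
      total 𝟙y R              ≡⟨ swapRows-total-y rows-afterXY ⟩
      total 𝟙x rows           ≡⟨ ∣map∣ hasX rows ⟨
      ∣ map hasX rows ∣       ≡⟨ cong ∣_∣ (map-hasX-rowsOf μ P₁ P₂) ⟩
      ∣ P₁ ∣                  ∎

    T₁-size : ∣ T₁ ∣ ≡ ℤ.∣ b ∣
    T₁-size = trans (∣raised∣ b ∣Q₁∣) (trans (cong ∣_∣ (raised-involutive b S₂)) size₂)

    T₂-size : ∣ T₂ ∣ ≡ ℤ.∣ a ∣
    T₂-size = trans (∣raised∣ a ∣Q₂∣) (trans (cong ∣_∣ (raised-involutive a S₁)) size₁)

  swapSteps-end : ∀ i → next (next μ b T₁) a T₂ i ≡ next (next μ a S₁) b S₂ i
  swapSteps-end i = begin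
    next (next μ b T₁) a T₂ i
      ≡⟨ two-steps μ b a T₁ T₂ T₁-size T₂-size i ⟩
    μ i ℤ.+ + (𝟙 (lookup (raised b T₁) i) + 𝟙 (lookup (raised a T₂) i)) ℤ.+ (shift b ℤ.+ shift a)
      ≡⟨ cong₂ (λ X Y → μ i ℤ.+ + (𝟙 (lookup X i) + 𝟙 (lookup Y i)) ℤ.+ (shift b ℤ.+ shift a)) raised-T₁ raised-T₂ ⟩
    μ i ℤ.+ + (𝟙 (lookup Q₁ i) + 𝟙 (lookup Q₂ i)) ℤ.+ (shift b ℤ.+ shift a)
      ≡⟨ cong₂ (λ n s → μ i ℤ.+ + n ℤ.+ s) (R-added i) (ℤ.+-comm (shift b) (shift a)) ⟩
    μ i ℤ.+ + (𝟙 (lookup P₁ i) + 𝟙 (lookup P₂ i)) ℤ.+ (shift a ℤ.+ shift b)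
      ≡⟨ two-steps μ a b S₁ S₂ size₁ size₂ i ⟨
    next (next μ a S₁) b S₂ i ∎

  swapSteps-valid : ValidPair μ b a T₁ T₂
  swapSteps-valid = record
    { start  = start
    ; size₁  = T₁-size
    ; size₂  = T₂-size
    ; middle = partition-descending afterX R (shift b) (swapRows-afterX rows-value) λ i → begin
        μ i ℤ.+ stepVec b T₁ i                            ≡⟨ cong (λ z → μ i ℤ.+ z) (stepVec-raised b T₁ T₁-size i) ⟩
        μ i ℤ.+ (+ 𝟙 (lookup (raised b T₁) i) ℤ.+ shift b)  ≡⟨ ℤ.+-assoc (μ i) _ (shift b) ⟨
        μ i ℤ.+ + 𝟙 (lookup (raised b T₁) i) ℤ.+ shift b    ≡⟨ cong₂ (λ v x → v ℤ.+ + 𝟙 x ℤ.+ shift b) (sym (R-value i))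
                                                               (trans (cong (λ X → lookup X i) raised-T₁) (VecP.lookup-map i hasX R)) ⟩
        afterX (lookup R i) ℤ.+ shift b                    ∎
    ; end    = partition-cong end swapSteps-end
    }

  swapSteps-involutive : swapSteps μ b a T₁ T₂ ≡ (S₁ , S₂)
  swapSteps-involutive = begin
    swapSteps μ b a T₁ T₂
      ≡⟨ cong (λ rs → raised a (map hasX (swapRows rs)) , raised b (map hasY (swapRows rs))) rows-swapped ⟩
    raised a (map hasX (swapRows R)) , raised b (map hasY (swapRows R))
      ≡⟨ cong (λ rs → raised a (map hasX rs) , raised b (map hasY rs)) (swapRows-involutive rows-afterX rows-afterXY) ⟩
    raised a (map hasX rows) , raised b (map hasY rows)
      ≡⟨ cong₂ (λ A B → raised a A , raised b B) (map-hasX-rowsOf μ P₁ P₂) (map-hasY-rowsOf μ P₁ P₂) ⟩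
    raised a P₁ , raised b P₂
      ≡⟨ cong₂ _,_ (raised-involutive a S₁) (raised-involutive b S₂) ⟩
    S₁ , S₂ ∎
    where
    rows-swapped : rowsOf μ (raised b T₁) (raised a T₂) ≡ R
    rows-swapped = trans (VecP.tabulate-cong λ i →
                           cong₂ _,_ (sym (R-value i))
                             (cong₂ _,_ (trans (cong (λ X → lookup X i) raised-T₁) (VecP.lookup-map i hasX R))
                                        (trans (cong (λ X → lookup X i) raised-T₂) (VecP.lookup-map i hasY R))))
                         (VecP.tabulate∘lookup R)

tabulate-surjective : ∀ {A : Set} {n} (xs : List A) → List.length xs ≡ n → Σ (Fin n → A) λ f → List.tabulate f ≡ xs
tabulate-surjective []       refl = (λ ()) , refl
tabulate-surjective (x ∷ xs) refl with f , f≡xs ← tabulate-surjective xs refl =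
  (λ { Fin.zero → x ; (Fin.suc k) → f k }) , cong (x ∷_) f≡xs

tabulate-injective : ∀ {A : Set} {n} {f g : Fin n → A} → List.tabulate f ≡ List.tabulate g → ∀ k → f k ≡ g k
tabulate-injective {n = suc n} eq Fin.zero    = ListP.∷-injectiveˡ eq
tabulate-injective {n = suc n} eq (Fin.suc k) = tabulate-injective (ListP.∷-injectiveʳ eq) k

module _ {r} (λ′ : Fin r → ℤ) where

  data Walk : (Fin r → ℤ) → List ℤ → List (Subset r) → Set where
    arrive : ∀ {μ} → (∀ i → μ i ≡ λ′ i) → Walk μ [] []
    step   : ∀ {μ c cs S Ss} → ∣ S ∣ ≡ ℤ.∣ c ∣ → IsGenPartition (next μ c S) → Walk (next μ c S) cs Ss →
             Walk μ (c ∷ cs) (S ∷ Ss)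

  next-cong : ∀ {μ μ′ : Fin r → ℤ} → (∀ i → μ i ≡ μ′ i) → ∀ c S i → next μ c S i ≡ next μ′ c S i
  next-cong μ≗μ′ c S i = cong (λ z → z ℤ.+ stepVec c S i) (μ≗μ′ i)

  walk-cong : ∀ {μ μ′ cs Ss} → (∀ i → μ i ≡ μ′ i) → Walk μ cs Ss → Walk μ′ cs Ss
  walk-cong μ≗μ′ (arrive μ≗λ′) = arrive (λ i → trans (sym (μ≗μ′ i)) (μ≗λ′ i))
  walk-cong μ≗μ′ (step {c = c} {S = S} size next-part w) =
    step size (partition-cong next-part (λ i → sym (next-cong μ≗μ′ c S i))) (walk-cong (next-cong μ≗μ′ c S) w)

  StepMap : Set
  StepMap = (Fin r → ℤ) → List (Subset r) → List (Subset r)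

  Extensional : StepMap → Set
  Extensional F = ∀ {μ μ′} → (∀ i → μ i ≡ μ′ i) → ∀ Ss → F μ Ss ≡ F μ′ Ss

  -- The maps act on bare step lists, so that round trips are equations; they must
  -- be extensional in μ because after a swap the intermediate partitions are only
  -- pointwise equal to the original ones.
  record WalkBijection (cs ds : List ℤ) : Set where
    field
      to from   : StepMap
      to-ext    : Extensional to
      from-ext  : Extensional from
      to-walk   : ∀ {μ Ss} → IsGenPartition μ → Walk μ cs Ss → Walk μ ds (to μ Ss)
      from-walk : ∀ {μ Ss} → IsGenPartition μ → Walk μ ds Ss → Walk μ cs (from μ Ss)
      from-to   : ∀ {μ Ss} → IsGenPartition μ → Walk μ cs Ss → from μ (to μ Ss) ≡ Ss
      to-from   : ∀ {μ Ss} → IsGenPartition μ → Walk μ ds Ss → to μ (from μ Ss) ≡ Ss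

  open WalkBijection

  walkBijection-refl : ∀ cs → WalkBijection cs cs
  walkBijection-refl cs = record
    { to = λ _ Ss → Ss ; from = λ _ Ss → Ss
    ; to-ext = λ _ _ → refl ; from-ext = λ _ _ → refl
    ; to-walk = λ _ w → w ; from-walk = λ _ w → w
    ; from-to = λ _ _ → refl ; to-from = λ _ _ → refl
    }

  walkBijection-trans : ∀ {cs ds es} → WalkBijection cs ds → WalkBijection ds es → WalkBijection cs es
  walkBijection-trans F G = record
    { to        = λ μ Ss → to G μ (to F μ Ss)
    ; from      = λ μ Ss → from F μ (from G μ Ss)
    ; to-ext    = λ μ≗μ′ Ss → trans (cong (to G _) (to-ext F μ≗μ′ Ss)) (to-ext G μ≗μ′ _)
    ; from-ext  = λ μ≗μ′ Ss → trans (cong (from F _) (from-ext G μ≗μ′ Ss)) (from-ext F μ≗μ′ _)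
    ; to-walk   = λ μ-part w → to-walk G μ-part (to-walk F μ-part w)
    ; from-walk = λ μ-part w → from-walk F μ-part (from-walk G μ-part w)
    ; from-to   = λ {μ} μ-part w →
        trans (cong (from F μ) (from-to G μ-part (to-walk F μ-part w))) (from-to F μ-part w)
    ; to-from   = λ {μ} μ-part w →
        trans (cong (to G μ) (to-from F μ-part (from-walk G μ-part w))) (to-from G μ-part w)
    }

  prepend : ℤ → StepMap → StepMap
  prepend c F μ []       = []
  prepend c F μ (S ∷ Ss) = S ∷ F (next μ c S) Ss

  walkBijection-prep : ∀ c {cs ds} → WalkBijection cs ds → WalkBijection (c ∷ cs) (c ∷ ds)
  walkBijection-prep c F = record
    { to        = prepend c (to F)
    ; from      = prepend c (from F)
    ; to-ext    = ext (to-ext F)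
    ; from-ext  = ext (from-ext F)
    ; to-walk   = λ { _ (step size part w) → step size part (to-walk F part w) }
    ; from-walk = λ { _ (step size part w) → step size part (from-walk F part w) }
    ; from-to   = λ { _ (step {S = S} _ part w) → cong (S ∷_) (from-to F part w) }
    ; to-from   = λ { _ (step {S = S} _ part w) → cong (S ∷_) (to-from F part w) }
    }
    where
    ext : ∀ {G} → Extensional G → Extensional (prepend c G)
    ext G-ext μ≗μ′ []       = refl
    ext G-ext μ≗μ′ (S ∷ Ss) = cong (S ∷_) (G-ext (next-cong μ≗μ′ c S) Ss)

  swapThen : ℤ → ℤ → StepMap → (Fin r → ℤ) → Subset r × Subset r → List (Subset r) → List (Subset r)
  swapThen a b F μ (T₁ , T₂) Ss = T₁ ∷ T₂ ∷ F (next (next μ b T₁) a T₂) Ss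

  exchange : ℤ → ℤ → StepMap → StepMap
  exchange a b F μ (S₁ ∷ S₂ ∷ Ss) = swapThen a b F μ (swapSteps μ a b S₁ S₂) Ss
  exchange a b F μ Ss             = Ss

  exchange-ext : ∀ a b {F} → Extensional F → Extensional (exchange a b F)
  exchange-ext a b F-ext μ≗μ′ []                = refl
  exchange-ext a b F-ext μ≗μ′ (S ∷ [])          = refl
  exchange-ext a b {F} F-ext {μ} {μ′} μ≗μ′ (S₁ ∷ S₂ ∷ Ss) =
    trans (cong (λ T → swapThen a b F μ T Ss) (swapSteps-cong μ≗μ′ a b S₁ S₂))
          (cong (λ X → T₁ ∷ T₂ ∷ X) (F-ext (next-cong (next-cong μ≗μ′ b T₁) a T₂) Ss))
    where
    T₁ = proj₁ (swapSteps μ′ a b S₁ S₂)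
    T₂ = proj₂ (swapSteps μ′ a b S₁ S₂)

  exchange-walk : ∀ a b {cs ds F} → (∀ {μ Ss} → IsGenPartition μ → Walk μ cs Ss → Walk μ ds (F μ Ss)) →
                  ∀ {μ Ss} → IsGenPartition μ → Walk μ (a ∷ b ∷ cs) Ss → Walk μ (b ∷ a ∷ ds) (exchange a b F μ Ss)
  exchange-walk a b F-walk {μ} μ-part (step {S = S₁} size₁ middle (step {S = S₂} size₂ end w)) =
    step T₁-size T₁-part (step T₂-size end′ (F-walk end′ (walk-cong (λ i → sym (swapSteps-end valid i)) w)))
    where
    valid : ValidPair μ a b S₁ S₂
    valid = record { start = μ-part ; size₁ = size₁ ; size₂ = size₂ ; middle = middle ; end = end }
    open ValidPair (swapSteps-valid valid) renaming (size₁ to T₁-size; size₂ to T₂-size; middle to T₁-part; end to end′)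

  exchange-inverse : ∀ a b {cs F G} → Extensional G → (∀ {μ Ss} → IsGenPartition μ → Walk μ cs Ss → G μ (F μ Ss) ≡ Ss) →
                     ∀ {μ Ss} → IsGenPartition μ → Walk μ (a ∷ b ∷ cs) Ss → exchange b a G μ (exchange a b F μ Ss) ≡ Ss
  exchange-inverse a b {F = F} {G} G-ext G∘F {μ} μ-part (step {S = S₁} size₁ middle (step {S = S₂} {Ss} size₂ end w)) =
    trans (cong (λ T → swapThen b a G μ T (F μ₂′ Ss)) (swapSteps-involutive valid))
          (cong (λ X → S₁ ∷ S₂ ∷ X) (trans (G-ext (λ i → sym (swapSteps-end valid i)) (F μ₂′ Ss))
                                          (G∘F (ValidPair.end (swapSteps-valid valid)) (walk-cong (λ i → sym (swapSteps-end valid i)) w))))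
    where
    valid : ValidPair μ a b S₁ S₂
    valid = record { start = μ-part ; size₁ = size₁ ; size₂ = size₂ ; middle = middle ; end = end }
    μ₂′ = next (next μ b (proj₁ (swapSteps μ a b S₁ S₂))) a (proj₂ (swapSteps μ a b S₁ S₂))

  walkBijection-swap : ∀ a b {cs ds} → WalkBijection cs ds → WalkBijection (a ∷ b ∷ cs) (b ∷ a ∷ ds)
  walkBijection-swap a b F = record
    { to        = exchange a b (to F)
    ; from      = exchange b a (from F)
    ; to-ext    = exchange-ext a b (to-ext F)
    ; from-ext  = exchange-ext b a (from-ext F)
    ; to-walk   = exchange-walk a b (to-walk F)
    ; from-walk = exchange-walk b a (from-walk F)
    ; from-to   = exchange-inverse a b (from-ext F) (from-to F)
    ; to-from   = exchange-inverse b a (to-ext F) (to-from F)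
    }

  walkBijection-↭ : ∀ {cs ds} → cs ↭ ds → WalkBijection cs ds
  walkBijection-↭ ↭.refl         = walkBijection-refl _
  walkBijection-↭ (↭.prep c π)   = walkBijection-prep c (walkBijection-↭ π)
  walkBijection-↭ (↭.swap a b π) = walkBijection-swap a b (walkBijection-↭ π)
  walkBijection-↭ (↭.trans π π′) = walkBijection-trans (walkBijection-↭ π) (walkBijection-↭ π′)

  walk-head : ∀ {n} {P : (Fin r → ℤ) → Set} (μ : Fin r → ℤ) (c : Fin n → ℤ) st → All P (walk μ c st) → P μ
  walk-head {zero}  μ c st (p ∷ _) = p
  walk-head {suc n} μ c st (p ∷ _) = p

  last-walk : ∀ {n} (μ : Fin r → ℤ) (c : Fin (suc n) → ℤ) st i →
              last (walk μ c st) i ≡ last (walk (next μ (c Fin.zero) (st Fin.zero)) (c ∘ Fin.suc) (st ∘ Fin.suc)) i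
  last-walk {zero}  μ c st i = refl
  last-walk {suc n} μ c st i = refl

  walk-of-steps : ∀ {n} (μ : Fin r → ℤ) (c : Fin n → ℤ) st →
                  (∀ k → ∣ st k ∣ ≡ ℤ.∣ c k ∣) → All IsGenPartition (walk μ c st) →
                  (∀ i → last (walk μ c st) i ≡ λ′ i) → Walk μ (List.tabulate c) (List.tabulate st)
  walk-of-steps {zero}  μ c st sizes _          shape = arrive shape
  walk-of-steps {suc n} μ c st sizes (_ ∷ parts) shape =
    step (sizes Fin.zero) (walk-head _ (c ∘ Fin.suc) (st ∘ Fin.suc) parts)
         (walk-of-steps _ (c ∘ Fin.suc) (st ∘ Fin.suc) (sizes ∘ Fin.suc) parts
                        (λ i → trans (sym (last-walk μ c st i)) (shape i)))

  walk-sizes : ∀ {n} {μ : Fin r → ℤ} (c : Fin n → ℤ) st → Walk μ (List.tabulate c) (List.tabulate st) →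
               ∀ k → ∣ st k ∣ ≡ ℤ.∣ c k ∣
  walk-sizes {suc n} c st (step size _ w) Fin.zero    = size
  walk-sizes {suc n} c st (step size _ w) (Fin.suc k) = walk-sizes (c ∘ Fin.suc) (st ∘ Fin.suc) w k

  walk-partitions : ∀ {n} {μ : Fin r → ℤ} (c : Fin n → ℤ) st → IsGenPartition μ → Walk μ (List.tabulate c) (List.tabulate st) →
                    All IsGenPartition (walk μ c st)
  walk-partitions {zero}  c st μ-part (arrive _)      = μ-part ∷ []
  walk-partitions {suc n} c st μ-part (step _ part w) = μ-part ∷ walk-partitions (c ∘ Fin.suc) (st ∘ Fin.suc) part w

  walk-shape : ∀ {n} {μ : Fin r → ℤ} (c : Fin n → ℤ) st → Walk μ (List.tabulate c) (List.tabulate st) →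
               ∀ i → last (walk μ c st) i ≡ λ′ i
  walk-shape {zero}      c st (arrive shape) = shape
  walk-shape {suc n} {μ} c st (step _ _ w) i =
    trans (last-walk μ c st i) (walk-shape (c ∘ Fin.suc) (st ∘ Fin.suc) w i)

  walk-length : ∀ {μ cs Ss} → Walk μ cs Ss → List.length Ss ≡ List.length cs
  walk-length (arrive _)   = refl
  walk-length (step _ _ w) = cong suc (walk-length w)

  open FluctuatingTableau

  zero-partition : IsGenPartition {r} (λ _ → 0ℤ)
  zero-partition _ _ _ = ℤ.≤-refl

  tableau-walk : ∀ {n c} (t : FluctuatingTableau r n c λ′) → Walk (λ _ → 0ℤ) (List.tabulate c) (List.tabulate (steps t))
  tableau-walk t = walk-of-steps _ _ (steps t) (stepSizes t) (partitions t) (shape t)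

  walk-tableau : ∀ {n} (c : Fin n → ℤ) {Ss} → Walk (λ _ → 0ℤ) (List.tabulate c) Ss →
                 Σ (FluctuatingTableau r n c λ′) λ t → List.tabulate (steps t) ≡ Ss
  walk-tableau c {Ss} w with st , refl ← tabulate-surjective Ss (trans (walk-length w) (ListP.length-tabulate c)) =
    record { steps = st ; stepSizes = walk-sizes c st w ; partitions = walk-partitions c st zero-partition w ; shape = walk-shape c st w } ,
    refl

  tableauBijection : ∀ {n} {c d : Fin n → ℤ} → WalkBijection (List.tabulate c) (List.tabulate d) → TableauBijection c d λ′
  tableauBijection {c = c} {d} F = record
    { to      = λ t → proj₁ (transport-to t)
    ; from    = λ u → proj₁ (transport-from u)
    ; from-to = λ t → tabulate-injective (begin
        List.tabulate (steps (proj₁ (transport-from (proj₁ (transport-to t)))))  ≡⟨ proj₂ (transport-from _) ⟩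
        from F _ (List.tabulate (steps (proj₁ (transport-to t))))                ≡⟨ cong (from F _) (proj₂ (transport-to t)) ⟩
        from F _ (to F _ (List.tabulate (steps t)))                              ≡⟨ from-to F zero-partition (tableau-walk t) ⟩
        List.tabulate (steps t)                                                   ∎)
    ; to-from = λ u → tabulate-injective (begin
        List.tabulate (steps (proj₁ (transport-to (proj₁ (transport-from u)))))  ≡⟨ proj₂ (transport-to _) ⟩
        to F _ (List.tabulate (steps (proj₁ (transport-from u))))                ≡⟨ cong (to F _) (proj₂ (transport-from u)) ⟩
        to F _ (from F _ (List.tabulate (steps u)))                              ≡⟨ to-from F zero-partition (tableau-walk u) ⟩
        List.tabulate (steps u)                                                   ∎)
    }
    where
    open ≡-Reasoning
    transport-to : (t : FluctuatingTableau r _ c λ′) →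
                   Σ (FluctuatingTableau r _ d λ′) λ u → List.tabulate (steps u) ≡ to F _ (List.tabulate (steps t))
    transport-to t = walk-tableau d (to-walk F zero-partition (tableau-walk t))
    transport-from : (u : FluctuatingTableau r _ d λ′) →
                     Σ (FluctuatingTableau r _ c λ′) λ t → List.tabulate (steps t) ≡ from F _ (List.tabulate (steps u))
    transport-from u = walk-tableau c (from-walk F zero-partition (tableau-walk u))

tabulate-↭-punchIn : ∀ {A : Set} {n} (c : Fin (suc n) → A) j → List.tabulate c ↭ c j ∷ List.tabulate (c ∘ Fin.punchIn j)
tabulate-↭-punchIn c Fin.zero = ↭.refl
tabulate-↭-punchIn {n = suc n} c (Fin.suc j) =
  ↭.trans (↭.prep (c Fin.zero) (tabulate-↭-punchIn (c ∘ Fin.suc) j)) (↭.swap _ _ ↭.refl)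

tabulate-↭-permute : ∀ {A : Set} {n} (c : Fin n → A) (σ : Permutation′ n) →
                     List.tabulate c ↭ List.tabulate (λ k → c (σ ⟨$⟩ʳ k))
tabulate-↭-permute {n = zero}  c σ = ↭.refl
tabulate-↭-permute {n = suc n} c σ =
  ↭.trans (tabulate-↭-punchIn c (σ ⟨$⟩ʳ Fin.zero))
    (↭.prep _ (↭.trans (tabulate-↭-permute _ (Perm.remove Fin.zero σ))
                        (↭.↭-reflexive (ListP.tabulate-cong λ k → cong c (sym (Perm.punchIn-permute σ Fin.zero k))))))

-- None of the side conditions on r, n, λ' and c is needed.
corollary2p6 : (r n : ℕ) → 1 ≤ r → 1 ≤ n →
    (λ' : Fin r → ℤ) → IsGenPartition λ' →
    (c : Fin n → ℤ) → (∀ k → ℤ.∣ c k ∣ ≤ r) →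
    (σ : Permutation′ n) →
    TableauBijection c (λ k → c (σ ⟨$⟩ʳ k)) λ'
corollary2p6 r n _ _ λ' _ c _ σ = tableauBijection λ' (walkBijection-↭ λ' (tabulate-↭-permute c σ))
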